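{- Let $\lambda$ be a strict partition with $n$ parts. Then \[ R^{(+1)}(\lambda)=\sum_{x\in\mathcal{B}(\lambda)}R(\lambda(x)). \]
   Context: For a strict partition $\lambda=(\lambda_1>\dots>\lambda_n>0)$, the shifted diagram is $\{(i,j):1\le i\le n,\ i\le j\le\lambda_i+i-1\}$ ($i$ = row, $j$ = column); we identify $\lambda$ with it. $R(\lambda)$ is the number of shifted Young diagrams $\mu$ (of strict partitions, including $\emptyset$) with $\mu\subseteq\lambda$. $R^{(+1)}(\lambda)=\sum_{\mu\subseteq\lambda}\mathrm{ddeg}(\mu)$, where $\mathrm{ddeg}(\mu)$ is the number of shifted Young diagrams covered by $\mu$ in the shifted Young's lattice (strict partitions ordered by inclusion), i.e. the number of cells whose removal from $\mu$ leaves a shifted Young diagram. The border $\mathcal{B}(\lambda)$ is the set of cells $(i,j)\in\lambda$ such that $(i+1,j+1)\notin\lambda$. For $x=(i,j)\in\mathcal{B}(\lambda)$ define $\lambda(x)=(\lambda_1-1,\dots,\lambda_{n-1}-1)$ if $x=(n,n)$, and otherwise $\lambda(x)=(\lambda_1-2,\dots,\lambda_{i-1}-2,\tilde\lambda_{i+1},\dots,\tilde\lambda_n)$, where $\tilde\lambda_t=\lambda_t-1$ if $\lambda_t+t-1=j$ and $\tilde\lambda_t=\lambda_t$ otherwise (zero parts are ignored). -}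

module Defs where

open import Data.Nat using (ℕ; zero; suc; _+_; _∸_; _≤_; _<_; _≟_; _≤?_; _<?_)
open import Data.Nat.ListAction using (sum)
open import Data.List using (List; []; _∷_; length; map; filter; upTo; concatMap; cartesianProduct; take; drop; _++_)
open import Data.List.Relation.Unary.All using (All; all?)
open import Data.List.Relation.Unary.Linked using (Linked; linked?)
open import Data.Product using (_×_; _,_)
open import Data.Product.Properties using (≡-dec)
open import Data.Unit using (⊤; tt)
open import Data.Empty using (⊥)
open import Data.Bool using (if_then_else_)
open import Relation.Nullary using (Dec; yes; no; ¬_; ¬?)
open import Relation.Nullary.Decidable using (_×-dec_; ⌊_⌋)

StrictPartition : List ℕ → Set
StrictPartition λ′ = Linked (λ a b → b < a) λ′ × All (0 <_) λ′

strictPartition? : (λ′ : List ℕ) → Dec (StrictPartition λ′)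
strictPartition? λ′ = linked? (λ a b → b <? a) λ′ ×-dec all? (0 <?_) λ′

-- i-th part, 1-based, 0 beyond the length
part : List ℕ → ℕ → ℕ
part []       _             = 0
part (a ∷ as) zero          = 0
part (a ∷ as) (suc zero)    = a
part (a ∷ as) (suc (suc i)) = part as (suc i)

head0 : List ℕ → ℕ
head0 []      = 0
head0 (a ∷ _) = a

-- Containment of shifted diagrams: rows of both diagrams start at the same
-- diagonal cell, so  μ ⊆ λ  iff  ℓ(μ) ≤ ℓ(λ) and μ_i ≤ λ_i for every i.
_⊑_ : List ℕ → List ℕ → Set
[]      ⊑ _       = ⊤
(a ∷ μ) ⊑ []      = ⊥
(a ∷ μ) ⊑ (b ∷ λ′) = (a ≤ b) × (μ ⊑ λ′)

_⊑?_ : (μ λ′ : List ℕ) → Dec (μ ⊑ λ′)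
[]      ⊑? _       = yes tt
(a ∷ μ) ⊑? []      = no (λ ())
(a ∷ μ) ⊑? (b ∷ λ′) = (a ≤? b) ×-dec (μ ⊑? λ′)

lists : ℕ → ℕ → List (List ℕ)
lists zero    m = [] ∷ []
lists (suc k) m = [] ∷ concatMap (λ a → map (a ∷_) (lists k m)) (upTo (suc m))

-- all strict partitions μ (including the empty one) with μ ⊆ λ
-- (any such μ has ℓ(μ) ≤ ℓ(λ) and parts ≤ λ₁, so it occurs in the candidate list)
subdiagrams : List ℕ → List (List ℕ)
subdiagrams λ′ = filter (λ μ → strictPartition? μ ×-dec (μ ⊑? λ′)) (lists (length λ′) (head0 λ′))

R : List ℕ → ℕ
R λ′ = length (subdiagrams λ′)

-- ddeg(μ) = number of shifted diagrams covered by μ in the shifted Young lattice,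
-- i.e. strict partitions ν ⊆ μ with |ν| + 1 = |μ|
ddeg : List ℕ → ℕ
ddeg μ = length (filter (λ ν → sum ν + 1 ≟ sum μ) (subdiagrams μ))

Rplus1 : List ℕ → ℕ
Rplus1 λ′ = sum (map ddeg (subdiagrams λ′))

-- cell (i,j) (1-based row i, column j) of the shifted diagram of λ:
-- 1 ≤ i ≤ n and i ≤ j ≤ λ_i + i - 1
InDiagram : List ℕ → ℕ × ℕ → Set
InDiagram λ′ (i , j) = (1 ≤ i) × (i ≤ length λ′) × (i ≤ j) × (j < part λ′ i + i)

inDiagram? : (λ′ : List ℕ) → (x : ℕ × ℕ) → Dec (InDiagram λ′ x)
inDiagram? λ′ (i , j) = (1 ≤? i) ×-dec (i ≤? length λ′) ×-dec (i ≤? j) ×-dec (j <? part λ′ i + i)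

cells : List ℕ → List (ℕ × ℕ)
cells λ′ = filter (inDiagram? λ′)
  (cartesianProduct (upTo (suc (length λ′))) (upTo (suc (head0 λ′ + length λ′))))

border : List ℕ → List (ℕ × ℕ)
border λ′ = filter (λ { (i , j) → ¬? (inDiagram? λ′ (suc i , suc j)) }) (cells λ′)

-- λ̃_t for t = i+1,…,n, with t the index of the first element of the list
tildeFrom : ℕ → ℕ → List ℕ → List ℕ
tildeFrom j t []       = []
tildeFrom j t (a ∷ as) =
  (if ⌊ a + t ∸ 1 ≟ j ⌋ then a ∸ 1 else a) ∷ tildeFrom j (suc t) as

dropZeros : List ℕ → List ℕ
dropZeros = filter (0 <?_)

lamAt : List ℕ → ℕ × ℕ → List ℕ
lamAt λ′ (i , j) with ≡-dec _≟_ _≟_ (i , j) (length λ′ , length λ′)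
... | yes _ = dropZeros (map (_∸ 1) (take (length λ′ ∸ 1) λ′))
... | no  _ = dropZeros (map (_∸ 2) (take (i ∸ 1) λ′) ++ tildeFrom j (suc i) (drop i λ′))

-- A subdiagram μ ⊆ λ is built row by row: μ₁ ≤ min(b, λ₁) for the current bound b, and
-- the remaining rows form a subdiagram of (λ₂, …) bounded by μ₁ − 1. Both sides are
-- evaluated through this recursion. A removable cell at the end of a row of μ of length
-- d + 1 lies on the diagonal j − i = d, and each diagonal d < λ₁ of λ contains exactly one
-- border cell x_d, in the row i with λ_{i+1} ≤ d < λ_i. So R^{(+1)}(λ) is the sum over d of
-- the number of pairs (μ, removable cell of μ on diagonal d), and this number equals
-- R(λ(x_d)) because both obey the same recursion: a first row of μ of length k + 1 > d + 1
-- corresponds to a first row of length k − 1 in λ(x_d), whose parts above row i are λ_t − 2,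
-- and for bounds below d the rows λ̃_{i+1}, … of λ(x_d) count like λ_{i+1}, ….

module Submission where

open import Defs
open import Data.Nat using (ℕ)
open import Data.List using (List; map)
open import Data.Nat.ListAction using (sum)
open import Relation.Binary.PropositionalEquality using (_≡_)

open import Data.Bool.Base using (Bool; true; false; if_then_else_; _∧_; not; T)
open import Data.Bool.Properties using (T-≡; T-∧; if-eta; if-cong; if-cong-then)
open import Data.Empty using (⊥-elim)
open import Data.List.Base using ([]; _∷_; _++_; concatMap; upTo; applyUpTo; length; filter; cartesianProduct; take; drop)
open import Data.List.Properties using (map-++; map-cong; map-∘)
open import Data.List.Relation.Unary.All using (All; []; _∷_)
open import Data.List.Relation.Unary.Linked as Linked using (Linked; []; [-]; _∷_)
open import Data.Nat using (_≟_; _≤?_)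
open import Data.Nat.Base using (zero; suc; _+_; _∸_; _≤_; _<_; _⊓_; _<ᵇ_; _≤ᵇ_; _≡ᵇ_; z≤n; s≤s)
open import Data.Nat.ListAction.Properties using (sum-++)
open import Data.Nat.Properties
open import Algebra.Properties.CommutativeSemigroup +-commutativeSemigroup using (interchange)
open import Data.Product.Base using (_×_; _,_; proj₁; proj₂)
open import Data.Product.Properties using (≡-dec)
open import Data.Unit.Base using (tt)
open import Function.Bundles using (Equivalence)
open import Relation.Binary.PropositionalEquality using (_≢_; refl; sym; trans; cong; cong₂; subst)
open import Relation.Nullary using (Dec; yes; no; ¬_; does)
open import Relation.Nullary.Decidable using (_×-dec_; dec-true; dec-false; ⌊_⌋; isYes≗does)
open Relation.Binary.PropositionalEquality.≡-Reasoning

-- Finite sums over an initial segment of ℕ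

sumBelow : ℕ → (ℕ → ℕ) → ℕ
sumBelow zero    g = 0
sumBelow (suc n) g = g 0 + sumBelow n (λ k → g (suc k))

sumBelow-cong : ∀ n {g h : ℕ → ℕ} → (∀ k → k < n → g k ≡ h k) → sumBelow n g ≡ sumBelow n h
sumBelow-cong zero    e = refl
sumBelow-cong (suc n) e = cong₂ _+_ (e 0 (s≤s z≤n)) (sumBelow-cong n (λ k k<n → e (suc k) (s≤s k<n)))

sumBelow-zeros : ∀ n {g : ℕ → ℕ} → (∀ k → k < n → g k ≡ 0) → sumBelow n g ≡ 0
sumBelow-zeros zero    e = refl
sumBelow-zeros (suc n) e = cong₂ _+_ (e 0 (s≤s z≤n)) (sumBelow-zeros n (λ k k<n → e (suc k) (s≤s k<n)))

sumBelow-+ : ∀ n (g h : ℕ → ℕ) → sumBelow n (λ k → g k + h k) ≡ sumBelow n g + sumBelow n h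
sumBelow-+ zero    g h = refl
sumBelow-+ (suc n) g h = trans
  (cong (g 0 + h 0 +_) (sumBelow-+ n (λ k → g (suc k)) (λ k → h (suc k))))
  (interchange (g 0) (h 0) _ _)

sumBelow-split : ∀ m n (g : ℕ → ℕ) → sumBelow (m + n) g ≡ sumBelow m g + sumBelow n (λ k → g (m + k))
sumBelow-split zero    n g = refl
sumBelow-split (suc m) n g =
  trans (cong (g 0 +_) (sumBelow-split m n (λ k → g (suc k)))) (sym (+-assoc (g 0) _ _))

sumBelow-suc : ∀ n (g : ℕ → ℕ) → sumBelow (suc n) g ≡ sumBelow n g + g n
sumBelow-suc zero    g = +-comm (g 0) 0
sumBelow-suc (suc n) g = trans (cong (g 0 +_) (sumBelow-suc n (λ k → g (suc k)))) (sym (+-assoc (g 0) _ _))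

sumBelow-comm : ∀ m n (f : ℕ → ℕ → ℕ) →
  sumBelow m (λ a → sumBelow n (f a)) ≡ sumBelow n (λ d → sumBelow m (λ a → f a d))
sumBelow-comm zero    n f = sym (sumBelow-zeros n (λ _ _ → refl))
sumBelow-comm (suc m) n f = trans
  (cong (sumBelow n (f 0) +_) (sumBelow-comm m n (λ a → f (suc a))))
  (sym (sumBelow-+ n (f 0) (λ d → sumBelow m (λ a → f (suc a) d))))

sumBelow-window : ∀ M lo hi {G g : ℕ → ℕ} → lo ≤ hi → hi ≤ M →
  (∀ j → lo ≤ j → j < hi → G j ≡ g j) → (∀ j → j < lo → G j ≡ 0) → (∀ j → hi ≤ j → j < M → G j ≡ 0) →
  sumBelow M G ≡ sumBelow (hi ∸ lo) (λ e → g (lo + e))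
sumBelow-window M zero zero _ _ _ _ outside = sumBelow-zeros M (λ j j<M → outside j z≤n j<M)
sumBelow-window (suc M) zero (suc hi) _ (s≤s hi≤M) inside _ outside =
  cong₂ _+_ (inside 0 z≤n (s≤s z≤n))
    (sumBelow-window M zero hi z≤n hi≤M (λ j _ j<hi → inside (suc j) z≤n (s≤s j<hi)) (λ _ ())
      (λ j hi≤j j<M → outside (suc j) (s≤s hi≤j) (s≤s j<M)))
sumBelow-window (suc M) (suc lo) (suc hi) (s≤s lo≤hi) (s≤s hi≤M) inside below outside =
  cong₂ _+_ (below 0 (s≤s z≤n))
    (sumBelow-window M lo hi lo≤hi hi≤M (λ j lo≤j j<hi → inside (suc j) (s≤s lo≤j) (s≤s j<hi))
      (λ j j<lo → below (suc j) (s≤s j<lo)) (λ j hi≤j j<M → outside (suc j) (s≤s hi≤j) (s≤s j<M)))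

sumBelow-truncate : ∀ m M {g h : ℕ → ℕ} → m ≤ M →
  (∀ a → a < m → g a ≡ h a) → (∀ a → m ≤ a → a < M → g a ≡ 0) → sumBelow M g ≡ sumBelow m h
sumBelow-truncate m M m≤M inside outside = sumBelow-window M 0 m z≤n m≤M (λ a _ → inside a) (λ _ ()) outside

sum-map-cong : ∀ {A : Set} {g h : A → ℕ} (xs : List A) → (∀ x → g x ≡ h x) → sum (map g xs) ≡ sum (map h xs)
sum-map-cong xs e = cong sum (map-cong e xs)

sum-map-zeros : ∀ {A : Set} {g : A → ℕ} (xs : List A) → (∀ x → g x ≡ 0) → sum (map g xs) ≡ 0
sum-map-zeros []       e = refl
sum-map-zeros (x ∷ xs) e = cong₂ _+_ (e x) (sum-map-zeros xs e)

sum-map-++ : ∀ {A : Set} (g : A → ℕ) (xs ys : List A) → sum (map g (xs ++ ys)) ≡ sum (map g xs) + sum (map g ys)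
sum-map-++ g xs ys = trans (cong sum (map-++ g xs ys)) (sum-++ (map g xs) (map g ys))

sum-map-map : ∀ {A B : Set} (g : B → ℕ) (f : A → B) (xs : List A) → sum (map g (map f xs)) ≡ sum (map (λ x → g (f x)) xs)
sum-map-map g f xs = cong sum (sym (map-∘ xs))

sum-map-concatMap : ∀ {A B : Set} (g : B → ℕ) (F : A → List B) (xs : List A) →
  sum (map g (concatMap F xs)) ≡ sum (map (λ x → sum (map g (F x))) xs)
sum-map-concatMap g F []       = refl
sum-map-concatMap g F (x ∷ xs) =
  trans (sum-map-++ g (F x) (concatMap F xs)) (cong (sum (map g (F x)) +_) (sum-map-concatMap g F xs))

sum-map-cartesianProduct : ∀ {A B : Set} (G : A × B → ℕ) (xs : List A) (ys : List B) →
  sum (map G (cartesianProduct xs ys)) ≡ sum (map (λ x → sum (map (λ y → G (x , y)) ys)) xs)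
sum-map-cartesianProduct G []       ys = refl
sum-map-cartesianProduct G (x ∷ xs) ys = trans (sum-map-++ G (map (x ,_) ys) (cartesianProduct xs ys))
  (cong₂ _+_ (sum-map-map G (x ,_) ys) (sum-map-cartesianProduct G xs ys))

sum-map-applyUpTo : ∀ {A : Set} (g : A → ℕ) (f : ℕ → A) n → sum (map g (applyUpTo f n)) ≡ sumBelow n (λ k → g (f k))
sum-map-applyUpTo g f zero    = refl
sum-map-applyUpTo g f (suc n) = cong (g (f 0) +_) (sum-map-applyUpTo g (λ k → f (suc k)) n)

sum-map-upTo : ∀ (g : ℕ → ℕ) n → sum (map g (upTo n)) ≡ sumBelow n g
sum-map-upTo g = sum-map-applyUpTo g (λ k → k)

sum-map-filter : ∀ {A : Set} {P : A → Set} (P? : (x : A) → Dec (P x)) (g : A → ℕ) (xs : List A) →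
  sum (map g (filter P? xs)) ≡ sum (map (λ x → if does (P? x) then g x else 0) xs)
sum-map-filter P? g [] = refl
sum-map-filter P? g (x ∷ xs) with does (P? x)
... | true  = cong (g x +_) (sum-map-filter P? g xs)
... | false = sum-map-filter P? g xs

length≡sum-map-1 : ∀ {A : Set} (xs : List A) → length xs ≡ sum (map (λ _ → 1) xs)
length≡sum-map-1 []       = refl
length≡sum-map-1 (x ∷ xs) = cong suc (length≡sum-map-1 xs)

T⇒≡true : ∀ {b} → T b → b ≡ true
T⇒≡true = Equivalence.to T-≡

¬T⇒≡false : ∀ {b} → ¬ T b → b ≡ false
¬T⇒≡false {true}  ¬t = ⊥-elim (¬t tt)
¬T⇒≡false {false} _  = refl

<⇒≤∸1 : ∀ {x a} → x < a → x ≤ a ∸ 1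
<⇒≤∸1 {a = suc a} (s≤s x≤a) = x≤a

≤∸1⇒< : ∀ {x a} → 0 < a → x ≤ a ∸ 1 → x < a
≤∸1⇒< {a = suc a} _ x≤a = s≤s x≤a

-- Subdiagrams counted row by row

-- Strictness of μ is enforced by passing the bound μ₁ ∸ 1 to its remaining rows.
fitsᵇ : ℕ → List ℕ → List ℕ → Bool
fitsᵇ b l       []      = true
fitsᵇ b []      (a ∷ μ) = false
fitsᵇ b (c ∷ l) (a ∷ μ) = (0 <ᵇ a) ∧ (a ≤ᵇ b) ∧ (a ≤ᵇ c) ∧ fitsᵇ (a ∸ 1) l μ

sumSub : (List ℕ → ℕ) → ℕ → List ℕ → ℕ
sumSub f b []      = f []
sumSub f b (c ∷ l) = f [] + sumBelow (b ⊓ c) (λ a → sumSub (λ μ → f (suc a ∷ μ)) a l)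

countSub : ℕ → List ℕ → ℕ
countSub = sumSub (λ _ → 1)

StrictDecreasing : List ℕ → Set
StrictDecreasing = Linked (λ a b → b < a)

fitsᵇ-sound : ∀ b l μ → T (fitsᵇ b l μ) → StrictPartition μ × μ ⊑ l × head0 μ ≤ b
fitsᵇ-sound b l       []      _ = ([] , []) , tt , z≤n
fitsᵇ-sound b (c ∷ l) (a ∷ μ) t
  with 0<a , t₁ ← Equivalence.to (T-∧ {0 <ᵇ a}) t
  with a≤b , t₂ ← Equivalence.to (T-∧ {a ≤ᵇ b}) t₁
  with a≤c , t₃ ← Equivalence.to (T-∧ {a ≤ᵇ c}) t₂
  with (decreasing , positive) , μ⊑l , head≤a∸1 ← fitsᵇ-sound (a ∸ 1) l μ t₃
  = (cons μ decreasing head≤a∸1 , <ᵇ⇒< 0 a 0<a ∷ positive) , (≤ᵇ⇒≤ a c a≤c , μ⊑l) , ≤ᵇ⇒≤ a b a≤b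
  where
  cons : ∀ μ → StrictDecreasing μ → head0 μ ≤ a ∸ 1 → StrictDecreasing (a ∷ μ)
  cons []      _ _ = [-]
  cons (_ ∷ _) d h = ≤∸1⇒< (<ᵇ⇒< 0 a 0<a) h ∷ d

fitsᵇ-complete : ∀ b l μ → StrictPartition μ → μ ⊑ l → head0 μ ≤ b → T (fitsᵇ b l μ)
fitsᵇ-complete b l       []      _ _ _ = tt
fitsᵇ-complete b (c ∷ l) (a ∷ μ) (decreasing , 0<a ∷ positive) (a≤c , μ⊑l) a≤b =
  Equivalence.from T-∧ (<⇒<ᵇ 0<a , Equivalence.from T-∧ (≤⇒≤ᵇ a≤b , Equivalence.from T-∧ (≤⇒≤ᵇ a≤c ,
    fitsᵇ-complete (a ∸ 1) l μ (Linked.tail decreasing , positive) μ⊑l (head≤ μ decreasing))))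
  where
  head≤ : ∀ μ → StrictDecreasing (a ∷ μ) → head0 μ ≤ a ∸ 1
  head≤ []      _           = z≤n
  head≤ (x ∷ μ) (x<a ∷ _) = <⇒≤∸1 x<a

fitsᵇ-cons : ∀ {a b c} l ρ → a < b ⊓ c → fitsᵇ b (c ∷ l) (suc a ∷ ρ) ≡ fitsᵇ a l ρ
fitsᵇ-cons {a} {b} {c} l ρ a<b⊓c
  rewrite T⇒≡true (≤⇒≤ᵇ (≤-trans a<b⊓c (m⊓n≤m b c))) | T⇒≡true (≤⇒≤ᵇ (≤-trans a<b⊓c (m⊓n≤n b c))) = refl

fitsᵇ-cons-false : ∀ {a b c} l ρ → b ⊓ c ≤ a → fitsᵇ b (c ∷ l) (suc a ∷ ρ) ≡ false
fitsᵇ-cons-false {a} {b} {c} l ρ b⊓c≤a with suc a ≤? b | suc a ≤? c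
... | no a≮b  | _ rewrite ¬T⇒≡false (λ t → a≮b (≤ᵇ⇒≤ (suc a) b t)) = refl
... | yes a<b | no a≮c rewrite T⇒≡true (≤⇒≤ᵇ a<b) | ¬T⇒≡false (λ t → a≮c (≤ᵇ⇒≤ (suc a) c t)) = refl
... | yes a<b | yes a<c = ⊥-elim (<⇒≱ (⊓-glb a<b a<c) b⊓c≤a)

sum-lists-suc : ∀ (g : List ℕ → ℕ) k m → sum (map g (lists (suc k) m))
  ≡ g [] + sumBelow (suc m) (λ a → sum (map (λ ρ → g (a ∷ ρ)) (lists k m)))
sum-lists-suc g k m = cong (g [] +_) (begin
  sum (map g (concatMap (λ a → map (a ∷_) (lists k m)) (upTo (suc m))))
    ≡⟨ sum-map-concatMap g (λ a → map (a ∷_) (lists k m)) (upTo (suc m)) ⟩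
  sum (map (λ a → sum (map g (map (a ∷_) (lists k m)))) (upTo (suc m)))
    ≡⟨ sum-map-upTo _ (suc m) ⟩
  sumBelow (suc m) (λ a → sum (map g (map (a ∷_) (lists k m))))
    ≡⟨ sumBelow-cong (suc m) (λ a _ → sum-map-map g (a ∷_) (lists k m)) ⟩
  sumBelow (suc m) (λ a → sum (map (λ ρ → g (a ∷ ρ)) (lists k m))) ∎)

sum-lists≡sumSub : ∀ k m f b l → length l ≤ k → b ⊓ head0 l ≤ m →
  sum (map (λ μ → if fitsᵇ b l μ then f μ else 0) (lists k m)) ≡ sumSub f b l
sum-lists≡sumSub zero    m f b []      _ _ = +-identityʳ (f [])
sum-lists≡sumSub (suc k) m f b []      _ _ = begin
  _ ≡⟨ sum-lists-suc _ k m ⟩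
  f [] + sumBelow (suc m) (λ _ → sum (map (λ _ → 0) (lists k m)))
    ≡⟨ cong (f [] +_) (sumBelow-zeros (suc m) (λ _ _ → sum-map-zeros (lists k m) (λ _ → refl))) ⟩
  f [] + 0 ≡⟨ +-identityʳ (f []) ⟩
  f [] ∎
sum-lists≡sumSub (suc k) m f b (c ∷ l) (s≤s l≤k) b⊓c≤m = begin
  _ ≡⟨ sum-lists-suc _ k m ⟩
  f [] + (sum (map (λ _ → 0) (lists k m)) + sumBelow m row)
    ≡⟨ cong (λ z → f [] + (z + sumBelow m row)) (sum-map-zeros (lists k m) (λ _ → refl)) ⟩
  f [] + sumBelow m row
    ≡⟨ cong (f [] +_) (sumBelow-truncate (b ⊓ c) m b⊓c≤m inside outside) ⟩
  sumSub f b (c ∷ l) ∎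
  where
  row : ℕ → ℕ
  row a = sum (map (λ ρ → if fitsᵇ b (c ∷ l) (suc a ∷ ρ) then f (suc a ∷ ρ) else 0) (lists k m))
  inside : ∀ a → a < b ⊓ c → row a ≡ sumSub (λ ρ → f (suc a ∷ ρ)) a l
  inside a a<b⊓c = trans
    (sum-map-cong (lists k m) (λ ρ → if-cong (fitsᵇ-cons l ρ a<b⊓c)))
    (sum-lists≡sumSub k m (λ ρ → f (suc a ∷ ρ)) a l l≤k
      (≤-trans (m⊓n≤m a (head0 l)) (≤-trans (<⇒≤ a<b⊓c) b⊓c≤m)))
  outside : ∀ a → b ⊓ c ≤ a → a < m → row a ≡ 0
  outside a b⊓c≤a _ = sum-map-zeros (lists k m)
    (λ ρ → if-cong (fitsᵇ-cons-false l ρ b⊓c≤a))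

does≡ : ∀ {P : Set} (P? : Dec P) {b} → (P → T b) → (T b → P) → does P? ≡ b
does≡ (yes p) to _    = sym (T⇒≡true (to p))
does≡ (no ¬p) _  from = sym (¬T⇒≡false (λ t → ¬p (from t)))

does-subdiagram≡fitsᵇ : ∀ l μ → does (strictPartition? μ ×-dec (μ ⊑? l)) ≡ fitsᵇ (head0 l) l μ
does-subdiagram≡fitsᵇ l μ = does≡ (strictPartition? μ ×-dec (μ ⊑? l))
  (λ (sp , μ⊑l) → fitsᵇ-complete (head0 l) l μ sp μ⊑l (head-⊑ μ l μ⊑l))
  (λ t → let sp , μ⊑l , _ = fitsᵇ-sound (head0 l) l μ t in sp , μ⊑l)
  where
  head-⊑ : ∀ μ l → μ ⊑ l → head0 μ ≤ head0 l
  head-⊑ []      l       _         = z≤n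
  head-⊑ (a ∷ μ) (c ∷ l) (a≤c , _) = a≤c

sum-subdiagrams : ∀ (g : List ℕ → ℕ) l → sum (map g (subdiagrams l)) ≡ sumSub g (head0 l) l
sum-subdiagrams g l = begin
  sum (map g (subdiagrams l))
    ≡⟨ sum-map-filter (λ μ → strictPartition? μ ×-dec (μ ⊑? l)) g (lists (length l) (head0 l)) ⟩
  sum (map (λ μ → if does (strictPartition? μ ×-dec (μ ⊑? l)) then g μ else 0) (lists (length l) (head0 l)))
    ≡⟨ sum-map-cong (lists (length l) (head0 l)) (λ μ → if-cong (does-subdiagram≡fitsᵇ l μ)) ⟩
  sum (map (λ μ → if fitsᵇ (head0 l) l μ then g μ else 0) (lists (length l) (head0 l)))
    ≡⟨ sum-lists≡sumSub (length l) (head0 l) g (head0 l) l ≤-refl (m⊓n≤m (head0 l) (head0 l)) ⟩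
  sumSub g (head0 l) l ∎

R≡countSub : ∀ l → R l ≡ countSub (head0 l) l
R≡countSub l = trans (length≡sum-map-1 (subdiagrams l)) (sum-subdiagrams (λ _ → 1) l)

sumSub-cong : ∀ {f g : List ℕ → ℕ} b l → (∀ ρ → T (fitsᵇ b l ρ) → f ρ ≡ g ρ) → sumSub f b l ≡ sumSub g b l
sumSub-cong b []      e = e [] tt
sumSub-cong b (c ∷ l) e = cong₂ _+_ (e [] tt) (sumBelow-cong (b ⊓ c) (λ a a<b⊓c →
  sumSub-cong a l (λ ρ t → e (suc a ∷ ρ) (subst T (sym (fitsᵇ-cons l ρ a<b⊓c)) t))))

sumSub-zeros : ∀ {f : List ℕ → ℕ} b l → (∀ ρ → T (fitsᵇ b l ρ) → f ρ ≡ 0) → sumSub f b l ≡ 0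
sumSub-zeros b []      e = e [] tt
sumSub-zeros b (c ∷ l) e = cong₂ _+_ (e [] tt) (sumBelow-zeros (b ⊓ c) (λ a a<b⊓c →
  sumSub-zeros a l (λ ρ t → e (suc a ∷ ρ) (subst T (sym (fitsᵇ-cons l ρ a<b⊓c)) t))))

sumSub-+ : ∀ (f g : List ℕ → ℕ) b l → sumSub (λ ρ → f ρ + g ρ) b l ≡ sumSub f b l + sumSub g b l
sumSub-+ f g b []      = refl
sumSub-+ f g b (c ∷ l) = trans
  (cong (f [] + g [] +_) (trans
    (sumBelow-cong (b ⊓ c) (λ a _ → sumSub-+ (λ ρ → f (suc a ∷ ρ)) (λ ρ → g (suc a ∷ ρ)) a l))
    (sumBelow-+ (b ⊓ c) (λ a → sumSub (λ ρ → f (suc a ∷ ρ)) a l) (λ a → sumSub (λ ρ → g (suc a ∷ ρ)) a l))))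
  (interchange (f []) (g []) _ _)

sumSub-restrict : ∀ (f : List ℕ → ℕ) b b′ l → b′ ≤ b →
  sumSub (λ ρ → if fitsᵇ b′ ρ ρ then f ρ else 0) b l ≡ sumSub f b′ l
sumSub-restrict f b b′ []      _     = refl
sumSub-restrict f b b′ (c ∷ l) b′≤b = cong (f [] +_)
  (sumBelow-truncate (b′ ⊓ c) (b ⊓ c) (⊓-monoˡ-≤ c b′≤b) inside outside)
  where
  term : ℕ → ℕ
  term a = sumSub (λ ρ → if fitsᵇ b′ (suc a ∷ ρ) (suc a ∷ ρ) then f (suc a ∷ ρ) else 0) a l
  inside : ∀ a → a < b′ ⊓ c → term a ≡ sumSub (λ ρ → f (suc a ∷ ρ)) a l
  inside a a<b′⊓c = trans
    (sumSub-cong a l (λ ρ _ → if-cong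
      (fitsᵇ-cons ρ ρ (⊓-glb (≤-trans a<b′⊓c (m⊓n≤m b′ c)) ≤-refl))))
    (sumSub-restrict (λ ρ → f (suc a ∷ ρ)) a a l ≤-refl)
  outside : ∀ a → b′ ⊓ c ≤ a → a < b ⊓ c → term a ≡ 0
  outside a b′⊓c≤a a<b⊓c = sumSub-zeros a l (λ ρ _ → if-cong
    (fitsᵇ-cons-false ρ ρ (≤-trans (⊓-monoʳ-≤ b′ (≤-trans a<b⊓c (m⊓n≤n b c))) b′⊓c≤a)))

-- Down-degree

δ : ℕ → ℕ → ℕ
δ m n = if m ≡ᵇ n then 1 else 0

δ-+ : ∀ k m n → δ (k + m) (k + n) ≡ δ m n
δ-+ zero    m n = refl
δ-+ (suc k) m n = δ-+ k m n

δ-< : ∀ {m n} → m < n → δ m n ≡ 0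
δ-< {m} {n} m<n = if-cong (¬T⇒≡false (λ t → <⇒≢ m<n (≡ᵇ⇒≡ m n t)))

⊑-sum : ∀ ρ l → ρ ⊑ l → sum ρ ≤ sum l
⊑-sum []      l       _         = z≤n
⊑-sum (a ∷ ρ) (c ∷ l) (a≤c , s) = +-mono-≤ a≤c (⊑-sum ρ l s)

fits-sum : ∀ b l ρ → T (fitsᵇ b l ρ) → sum ρ ≤ sum l
fits-sum b l ρ t = ⊑-sum ρ l (proj₁ (proj₂ (fitsᵇ-sound b l ρ t)))

sumSub-δ-sum : ∀ b l → All (0 <_) l → sumSub (λ ρ → δ (sum ρ) (sum l)) b l ≡ (if fitsᵇ b l l then 1 else 0)
sumSub-δ-sum b []          _              = refl
sumSub-δ-sum b (suc c ∷ l) (_ ∷ positive) with suc c ≤? b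
... | yes c<b = begin
  sumBelow (b ⊓ suc c) term    ≡⟨ cong (λ n → sumBelow n term) (m≥n⇒m⊓n≡n c<b) ⟩
  sumBelow (suc c) term        ≡⟨ sumBelow-suc c term ⟩
  sumBelow c term + term c     ≡⟨ cong₂ _+_ (sumBelow-zeros c short) (sumSub-cong c l (λ ρ _ → δ-+ (suc c) (sum ρ) (sum l))) ⟩
  sumSub (λ ρ → δ (sum ρ) (sum l)) c l ≡⟨ sumSub-δ-sum c l positive ⟩
  (if fitsᵇ c l l then 1 else 0) ≡⟨ if-cong (sym (fitsᵇ-cons l l (⊓-glb c<b ≤-refl))) ⟩
  _ ∎
  where
  term : ℕ → ℕ
  term a = sumSub (λ ρ → δ (suc a + sum ρ) (suc c + sum l)) a l
  short : ∀ a → a < c → term a ≡ 0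
  short a a<c = sumSub-zeros a l (λ ρ t → δ-< (s≤s (+-mono-<-≤ a<c (fits-sum a l ρ t))))
... | no c≮b = trans
  (sumBelow-zeros (b ⊓ suc c) (λ a a<b⊓c → sumSub-zeros a l (λ ρ t →
    δ-< (s≤s (+-mono-<-≤ (≤-trans a<b⊓c b⊓c≤c) (fits-sum a l ρ t))))))
  (if-cong (sym (fitsᵇ-cons-false l l b⊓c≤c)))
  where
  b⊓c≤c : b ⊓ suc c ≤ c
  b⊓c≤c = ≤-trans (m⊓n≤m b (suc c)) (≤-pred (≰⇒> c≮b))

fitsᵇ-tail : ∀ b c l → T (fitsᵇ b (c ∷ l) (c ∷ l)) → T (fitsᵇ (c ∸ 1) l l)
fitsᵇ-tail b c l t =
  proj₂ (Equivalence.to (T-∧ {c ≤ᵇ c}) (proj₂ (Equivalence.to (T-∧ {c ≤ᵇ b}) (proj₂ (Equivalence.to (T-∧ {0 <ᵇ c}) t)))))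

corners : List ℕ → ℕ
corners []      = 0
corners (c ∷ l) = (if fitsᵇ (c ∸ 2) l l then 1 else 0) + corners l

-- A ν ⊆ μ with |ν| + 1 = |μ| either shortens the first row of μ by one cell and agrees
-- with μ below it, or keeps the first row.
sumSub-δ-suc-sum : ∀ b l → T (fitsᵇ b l l) → sumSub (λ ρ → δ (suc (sum ρ)) (sum l)) b l ≡ corners l
sumSub-δ-suc-sum b []    _ = refl
sumSub-δ-suc-sum b (suc zero ∷ []) t =
  cong (λ n → 1 + sumBelow n (λ a → δ (suc (suc a + 0)) 1)) (m≥n⇒m⊓n≡n (proj₂ (proj₂ (fitsᵇ-sound b (1 ∷ []) (1 ∷ []) t))))
sumSub-δ-suc-sum b (suc zero ∷ x ∷ l) t
  with (_ , 0<x ∷ _) , _ , x≤0 ← fitsᵇ-sound 0 (x ∷ l) (x ∷ l) (fitsᵇ-tail b 1 (x ∷ l) t)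
  = ⊥-elim (<⇒≱ 0<x x≤0)
sumSub-δ-suc-sum b (suc (suc c) ∷ l) t = begin
  sumBelow (b ⊓ suc (suc c)) term
    ≡⟨ cong (λ n → sumBelow n term) (m≥n⇒m⊓n≡n (proj₂ (proj₂ (fitsᵇ-sound b (suc (suc c) ∷ l) (suc (suc c) ∷ l) t)))) ⟩
  sumBelow (suc (suc c)) term
    ≡⟨ trans (sumBelow-suc (suc c) term) (cong (_+ term (suc c)) (sumBelow-suc c term)) ⟩
  sumBelow c term + term c + term (suc c)
    ≡⟨ cong₂ (λ x y → x + y + term (suc c)) (sumBelow-zeros c short) (sumSub-cong c l (λ ρ _ → δ-+ c (sum ρ) (sum l))) ⟩
  sumSub (λ ρ → δ (sum ρ) (sum l)) c l + term (suc c)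
    ≡⟨ cong₂ _+_ (sumSub-δ-sum c l positive) (sumSub-cong (suc c) l (λ ρ _ → shift (sum ρ))) ⟩
  (if fitsᵇ c l l then 1 else 0) + sumSub (λ ρ → δ (suc (sum ρ)) (sum l)) (suc c) l
    ≡⟨ cong ((if fitsᵇ c l l then 1 else 0) +_) (sumSub-δ-suc-sum (suc c) l (fitsᵇ-tail b (suc (suc c)) l t)) ⟩
  corners (suc (suc c) ∷ l) ∎
  where
  positive : All (0 <_) l
  positive with (_ , _ ∷ positive) , _ ← fitsᵇ-sound b (suc (suc c) ∷ l) (suc (suc c) ∷ l) t = positive
  term : ℕ → ℕ
  term a = sumSub (λ ρ → δ (suc (suc a + sum ρ)) (suc (suc c) + sum l)) a l
  short : ∀ a → a < c → term a ≡ 0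
  short a a<c = sumSub-zeros a l (λ ρ t → δ-< (s≤s (s≤s (+-mono-<-≤ a<c (fits-sum a l ρ t)))))
  shift : ∀ x → δ (suc (suc c + x)) (suc c + sum l) ≡ δ (suc x) (sum l)
  shift x = trans (cong (λ y → δ (suc y) (suc c + sum l)) (sym (+-suc c x))) (δ-+ (suc c) (suc x) (sum l))

ddeg≡corners : ∀ μ → StrictPartition μ → ddeg μ ≡ corners μ
ddeg≡corners μ sp = begin
  ddeg μ
    ≡⟨ length≡sum-map-1 (filter (λ ν → sum ν + 1 ≟ sum μ) (subdiagrams μ)) ⟩
  sum (map (λ _ → 1) (filter (λ ν → sum ν + 1 ≟ sum μ) (subdiagrams μ)))
    ≡⟨ sum-map-filter (λ ν → sum ν + 1 ≟ sum μ) (λ _ → 1) (subdiagrams μ) ⟩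
  sum (map (λ ν → δ (sum ν + 1) (sum μ)) (subdiagrams μ))
    ≡⟨ sum-subdiagrams _ μ ⟩
  sumSub (λ ν → δ (sum ν + 1) (sum μ)) (head0 μ) μ
    ≡⟨ sumSub-cong (head0 μ) μ (λ ν _ → cong (λ n → δ n (sum μ)) (+-comm (sum ν) 1)) ⟩
  sumSub (λ ν → δ (suc (sum ν)) (sum μ)) (head0 μ) μ
    ≡⟨ sumSub-δ-suc-sum (head0 μ) μ (fitsᵇ-complete (head0 μ) μ μ sp (⊑-refl μ) ≤-refl) ⟩
  corners μ ∎
  where
  ⊑-refl : ∀ l → l ⊑ l
  ⊑-refl []      = tt
  ⊑-refl (c ∷ l) = ≤-refl , ⊑-refl l

sumSub-corners : ∀ b c l →
  sumSub corners b (c ∷ l) ≡ sumBelow (b ⊓ c) (λ a → countSub (a ∸ 1) l + sumSub corners a l)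
sumSub-corners b c l = sumBelow-cong (b ⊓ c) (λ a _ → trans
  (sumSub-+ (λ ρ → if fitsᵇ (a ∸ 1) ρ ρ then 1 else 0) corners a l)
  (cong (_+ sumSub corners a l) (sumSub-restrict (λ _ → 1) a (a ∸ 1) l (m∸n≤m a 1))))

Rplus1≡sumSub-corners : ∀ l → Rplus1 l ≡ sumSub corners (head0 l) l
Rplus1≡sumSub-corners l = trans (sum-subdiagrams ddeg l)
  (sumSub-cong (head0 l) l (λ μ t → ddeg≡corners μ (proj₁ (fitsᵇ-sound (head0 l) l μ t))))

-- Corners sorted by diagonal

-- cornersOn d b λ counts the pairs (μ, x) with μ fitting b in λ and x a removable
-- cell of μ on the diagonal j − i = d, i.e. at the end of a row of length d + 1.
cornersOn : ℕ → ℕ → List ℕ → ℕ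
cornersOn d b []      = 0
cornersOn d b (c ∷ l) =
  (if d <ᵇ b ⊓ c then countSub (d ∸ 1) l else 0) + sumBelow (b ⊓ c) (λ a → if d <ᵇ a then cornersOn d a l else 0)

if-<ᵇ-yes : ∀ {d m} (x y : ℕ) → d < m → (if d <ᵇ m then x else y) ≡ x
if-<ᵇ-yes x y d<m rewrite T⇒≡true (<⇒<ᵇ d<m) = refl

if-<ᵇ-no : ∀ {d m} (x y : ℕ) → m ≤ d → (if d <ᵇ m then x else y) ≡ y
if-<ᵇ-no {d} {m} x y m≤d rewrite ¬T⇒≡false (λ t → <⇒≱ (<ᵇ⇒< d m t) m≤d) = refl

sumSub-corners≡sum-cornersOn : ∀ b l M → b ⊓ head0 l ≤ M → sumSub corners b l ≡ sumBelow M (λ d → cornersOn d b l)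
sumSub-corners≡sum-cornersOn b []      M _ = sym (sumBelow-zeros M (λ _ _ → refl))
sumSub-corners≡sum-cornersOn b (c ∷ l) M m≤M = sym (begin
  sumBelow M (λ d → cornersOn d b (c ∷ l))
    ≡⟨ sumBelow-+ M (λ d → if d <ᵇ m then countSub (d ∸ 1) l else 0) (λ d → sumBelow m (deeper d)) ⟩
  sumBelow M (λ d → if d <ᵇ m then countSub (d ∸ 1) l else 0) + sumBelow M (λ d → sumBelow m (deeper d))
    ≡⟨ cong₂ _+_ (sumBelow-truncate m M m≤M (λ d d<m → if-<ᵇ-yes _ _ d<m) (λ d m≤d _ → if-<ᵇ-no _ _ m≤d))
                 (sym (sumBelow-comm m M (λ a d → deeper d a))) ⟩
  sumBelow m (λ d → countSub (d ∸ 1) l) + sumBelow m (λ a → sumBelow M (λ d → deeper d a))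
    ≡⟨ cong (sumBelow m (λ d → countSub (d ∸ 1) l) +_) (sumBelow-cong m (λ a a<m →
         trans (sumBelow-truncate a M (≤-trans (<⇒≤ a<m) m≤M) (λ d d<a → if-<ᵇ-yes _ _ d<a) (λ d a≤d _ → if-<ᵇ-no _ _ a≤d))
               (sym (sumSub-corners≡sum-cornersOn a l a (m⊓n≤m a (head0 l)))))) ⟩
  sumBelow m (λ d → countSub (d ∸ 1) l) + sumBelow m (λ a → sumSub corners a l)
    ≡⟨ sym (sumBelow-+ m (λ d → countSub (d ∸ 1) l) (λ a → sumSub corners a l)) ⟩
  sumBelow m (λ a → countSub (a ∸ 1) l + sumSub corners a l)
    ≡⟨ sym (sumSub-corners b c l) ⟩
  sumSub corners b (c ∷ l) ∎)
  where
  m : ℕ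
  m = b ⊓ c
  deeper : ℕ → ℕ → ℕ
  deeper d a = if d <ᵇ a then cornersOn d a l else 0

head-tail≤ : ∀ {c l} → StrictDecreasing (c ∷ l) → head0 l ≤ c
head-tail≤ {l = []}    _           = z≤n
head-tail≤ {l = _ ∷ _} (x<c ∷ _) = <⇒≤ x<c

part-1 : ∀ l → part l 1 ≡ head0 l
part-1 []      = refl
part-1 (c ∷ l) = refl

part-suc-≤ : ∀ l k → StrictDecreasing l → part l (suc (suc k)) ≤ part l (suc k)
part-suc-≤ []          k       _         = z≤n
part-suc-≤ (c ∷ [])    k       _         = z≤n
part-suc-≤ (c ∷ x ∷ l) zero    (x<c ∷ _) = <⇒≤ x<c
part-suc-≤ (c ∷ x ∷ l) (suc k) (_ ∷ dec) = part-suc-≤ (x ∷ l) k dec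

part-≤-head : ∀ l k → StrictDecreasing l → part l k ≤ head0 l
part-≤-head []      k             _   = z≤n
part-≤-head (c ∷ l) zero          _   = z≤n
part-≤-head (c ∷ l) (suc zero)    _   = ≤-refl
part-≤-head (c ∷ l) (suc (suc k)) dec = ≤-trans (part-≤-head l (suc k) (Linked.tail dec)) (head-tail≤ dec)

part-pos⇒≤length : ∀ l k → 0 < part l k → k ≤ length l
part-pos⇒≤length (c ∷ l) zero          _ = z≤n
part-pos⇒≤length (c ∷ l) (suc zero)    _ = s≤s z≤n
part-pos⇒≤length (c ∷ l) (suc (suc k)) p = s≤s (part-pos⇒≤length l (suc k) p)

-- [0, λ₁) is the disjoint union of the intervals [λ_{i+1}, λ_i).
sumBelow-rows : ∀ (h : ℕ → ℕ) l → StrictDecreasing l →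
  sumBelow (head0 l) h ≡ sumBelow (length l) (λ i → sumBelow (part l (suc i) ∸ part l (suc (suc i))) (λ e → h (part l (suc (suc i)) + e)))
sumBelow-rows h []      _   = refl
sumBelow-rows h (c ∷ l) dec = begin
  sumBelow c h                                    ≡⟨ cong (λ n → sumBelow n h) (sym (m+[n∸m]≡n (head-tail≤ dec))) ⟩
  sumBelow (head0 l + (c ∸ head0 l)) h            ≡⟨ sumBelow-split (head0 l) (c ∸ head0 l) h ⟩
  sumBelow (head0 l) h + sumBelow (c ∸ head0 l) (λ e → h (head0 l + e))
    ≡⟨ +-comm (sumBelow (head0 l) h) _ ⟩
  sumBelow (c ∸ head0 l) (λ e → h (head0 l + e)) + sumBelow (head0 l) h
    ≡⟨ cong₂ _+_ (cong (λ x → sumBelow (c ∸ x) (λ e → h (x + e))) (sym (part-1 l))) (sumBelow-rows h l (Linked.tail dec)) ⟩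
  sumBelow (suc (length l)) (λ i → sumBelow (part (c ∷ l) (suc i) ∸ part (c ∷ l) (suc (suc i))) (λ e → h (part (c ∷ l) (suc (suc i)) + e))) ∎

borderTerm : List ℕ → (ℕ × ℕ → ℕ) → ℕ → ℕ → ℕ
borderTerm l g i j =
  if does (inDiagram? l (i , j)) then (if not (does (inDiagram? l (suc i , suc j))) then g (i , j) else 0) else 0

borderTerm-≡ : ∀ l g i j {b₁ b₂} → does (inDiagram? l (i , j)) ≡ b₁ → does (inDiagram? l (suc i , suc j)) ≡ b₂ →
  borderTerm l g i j ≡ (if b₁ then (if not b₂ then g (i , j) else 0) else 0)
borderTerm-≡ l g i j = cong₂ (λ x y → if x then (if not y then g (i , j) else 0) else 0)

sumBelow-borderTerm : ∀ l g i M → 1 ≤ i → i ≤ length l → part l (suc i) ≤ part l i → i + part l i ≤ M →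
  sumBelow M (borderTerm l g i) ≡ sumBelow (part l i ∸ part l (suc i)) (λ e → g (i , i + part l (suc i) + e))
sumBelow-borderTerm l g i M 1≤i i≤n next≤this end≤M = trans
  (sumBelow-window M (i + part l (suc i)) (i + part l i) (+-monoʳ-≤ i next≤this) end≤M on-border below beyond)
  (cong (λ n → sumBelow n (λ e → g (i , i + part l (suc i) + e))) ([m+n]∸[m+o]≡n∸o i (part l i) (part l (suc i))))
  where
  flip : ∀ {j k} → j < i + k → suc j < k + suc i
  flip {j} {k} j<i+k = subst (suc j <_) (sym (trans (+-suc k i) (cong suc (+-comm k i)))) (s≤s j<i+k)
  on-border : ∀ j → i + part l (suc i) ≤ j → j < i + part l i → borderTerm l g i j ≡ g (i , j)
  on-border j start≤j j<end = borderTerm-≡ l g i j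
    (dec-true (inDiagram? l (i , j)) (1≤i , i≤n , ≤-trans (m≤m+n i _) start≤j , subst (j <_) (+-comm i (part l i)) j<end))
    (dec-false (inDiagram? l (suc i , suc j)) (λ (_ , _ , _ , j<) → <⇒≱ (≤-pred (flip⁻¹ j<)) start≤j))
    where
    flip⁻¹ : suc j < part l (suc i) + suc i → suc j < suc (i + part l (suc i))
    flip⁻¹ = subst (suc j <_) (trans (+-suc (part l (suc i)) i) (cong suc (+-comm (part l (suc i)) i)))
  below : ∀ j → j < i + part l (suc i) → borderTerm l g i j ≡ 0
  below j j<start with i ≤? j
  ... | no i≰j = borderTerm-≡ l g i j (dec-false (inDiagram? l (i , j)) (λ (_ , _ , i≤j , _) → i≰j i≤j)) refl
  ... | yes i≤j = trans (borderTerm-≡ l g i j refl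
      (dec-true (inDiagram? l (suc i , suc j)) (s≤s z≤n , part-pos⇒≤length l (suc i) next-pos , s≤s i≤j , flip j<start)))
      (if-eta (does (inDiagram? l (i , j))))
    where
    next-pos : 0 < part l (suc i)
    next-pos with part l (suc i)
    ... | zero  = ⊥-elim (<⇒≱ j<start (subst (_≤ j) (sym (+-identityʳ i)) i≤j))
    ... | suc _ = s≤s z≤n
  beyond : ∀ j → i + part l i ≤ j → j < M → borderTerm l g i j ≡ 0
  beyond j end≤j _ = borderTerm-≡ l g i j (dec-false (inDiagram? l (i , j))
    (λ (_ , _ , _ , j<) → <⇒≱ j< (subst (_≤ j) (+-comm i (part l i)) end≤j))) refl

sum-border : ∀ l (g : ℕ × ℕ → ℕ) → StrictDecreasing l →
  sum (map g (border l)) ≡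
  sumBelow (length l) (λ i → sumBelow (part l (suc i) ∸ part l (suc (suc i))) (λ e → g (suc i , suc i + part l (suc (suc i)) + e)))
sum-border l g dec = begin
  sum (map g (border l))
    ≡⟨ trans (sum-map-filter _ g (cells l)) (sum-map-filter (inDiagram? l) _ (cartesianProduct (upTo (suc n)) (upTo M))) ⟩
  sum (map (λ (i , j) → borderTerm l g i j) (cartesianProduct (upTo (suc n)) (upTo M)))
    ≡⟨ sum-map-cartesianProduct _ (upTo (suc n)) (upTo M) ⟩
  sum (map (λ i → sum (map (borderTerm l g i) (upTo M))) (upTo (suc n)))
    ≡⟨ trans (sum-map-upTo _ (suc n)) (sumBelow-cong (suc n) (λ i _ → sum-map-upTo (borderTerm l g i) M)) ⟩
  sumBelow (suc n) (λ i → sumBelow M (borderTerm l g i))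
    ≡⟨ cong₂ _+_ (sumBelow-zeros M (λ j _ → refl)) (sumBelow-cong n row) ⟩
  sumBelow n (λ i → sumBelow (part l (suc i) ∸ part l (suc (suc i))) (λ e → g (suc i , suc i + part l (suc (suc i)) + e))) ∎
  where
  n M : ℕ
  n = length l
  M = suc (head0 l + n)
  row : ∀ i → i < n → sumBelow M (borderTerm l g (suc i)) ≡
    sumBelow (part l (suc i) ∸ part l (suc (suc i))) (λ e → g (suc i , suc i + part l (suc (suc i)) + e))
  row i i<n = sumBelow-borderTerm l g (suc i) M (s≤s z≤n) i<n (part-suc-≤ l i dec)
    (≤-trans (≤-reflexive (+-comm (suc i) (part l (suc i)))) (≤-trans (+-mono-≤ (part-≤-head l (suc i) dec) i<n) (n≤1+n _)))

-- Counting subdiagrams of λ(x)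

WeaklyDecreasing : List ℕ → Set
WeaklyDecreasing = Linked (λ a b → b ≤ a)

countSub-∷ : ∀ c x l → c ≤ x → countSub c (x ∷ l) ≡ 1 + sumBelow c (λ a → countSub a l)
countSub-∷ c x l c≤x = cong (λ n → 1 + sumBelow n (λ a → countSub a l)) (m≤n⇒m⊓n≡m c≤x)

countSub-bound : ∀ c c′ l → head0 l ≤ c → head0 l ≤ c′ → countSub c l ≡ countSub c′ l
countSub-bound c c′ []      _   _    = refl
countSub-bound c c′ (x ∷ l) x≤c x≤c′ =
  cong (λ n → 1 + sumBelow n (λ a → countSub a l)) (trans (m≥n⇒m⊓n≡n x≤c) (sym (m≥n⇒m⊓n≡n x≤c′)))

dropZeros-≤0 : ∀ l → WeaklyDecreasing (0 ∷ l) → dropZeros l ≡ []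
dropZeros-≤0 []          _         = refl
dropZeros-≤0 (zero ∷ l)  (_ ∷ dec) = dropZeros-≤0 l dec

countSub-dropZeros : ∀ c l → WeaklyDecreasing l → countSub c (dropZeros l) ≡ countSub c l
countSub-dropZeros c []          _   = refl
countSub-dropZeros c (zero ∷ l)  dec =
  trans (cong (countSub c) (dropZeros-≤0 l dec)) (cong (λ n → 1 + sumBelow n (λ a → countSub a l)) (sym (⊓-zeroʳ c)))
countSub-dropZeros c (suc x ∷ l) dec =
  cong (1 +_) (sumBelow-cong (c ⊓ suc x) (λ a _ → countSub-dropZeros a l (Linked.tail dec)))

tilde : ℕ → ℕ → ℕ → ℕ
tilde j t x = if ⌊ x + t ∸ 1 ≟ j ⌋ then x ∸ 1 else x

tilde≡ : ∀ j t x → tilde j t x ≡ (if x + t ∸ 1 ≡ᵇ j then x ∸ 1 else x)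
tilde≡ j t x = if-cong (isYes≗does (x + t ∸ 1 ≟ j))

tilde-≤ : ∀ j t x → tilde j t x ≤ x
tilde-≤ j t x with x + t ∸ 1 ≟ j
... | yes _ = m∸n≤m x 1
... | no  _ = ≤-refl

∸1≤tilde : ∀ j t x → x ∸ 1 ≤ tilde j t x
∸1≤tilde j t x with x + t ∸ 1 ≟ j
... | yes _ = ≤-refl
... | no  _ = m∸n≤m x 1

tildeFrom-weaklyDecreasing : ∀ j t l → StrictDecreasing l → WeaklyDecreasing (tildeFrom j t l)
tildeFrom-weaklyDecreasing j t []          _           = []
tildeFrom-weaklyDecreasing j t (x ∷ [])    _           = [-]
tildeFrom-weaklyDecreasing j t (x ∷ y ∷ l) (y<x ∷ dec) =
  ≤-trans (tilde-≤ j (suc t) y) (≤-trans (<⇒≤∸1 y<x) (∸1≤tilde j t x)) ∷ tildeFrom-weaklyDecreasing j (suc t) (y ∷ l) dec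

tildeFrom-suc : ∀ j t l → tildeFrom (suc j) (suc (suc t)) l ≡ tildeFrom j (suc t) l
tildeFrom-suc j t []      = refl
tildeFrom-suc j t (x ∷ l) = cong₂ _∷_ (head-eq x) (tildeFrom-suc j (suc t) l)
  where
  head-eq : ∀ x → tilde (suc j) (suc (suc t)) x ≡ tilde j (suc t) x
  head-eq x rewrite tilde≡ (suc j) (suc (suc t)) x | tilde≡ j (suc t) x | +-suc x (suc t) | +-suc x t = refl

-- Lowering the row of λ that ends in column j does not matter for bounds c ≤ j − t.
countSub-tildeFrom : ∀ l j t c → StrictDecreasing l → 1 ≤ t → c + t ≤ j → head0 l + t ≤ suc j →
  countSub c (tildeFrom j t l) ≡ countSub c l
countSub-tildeFrom []      j t c _   _   _     _       = refl
countSub-tildeFrom (x ∷ l) j t c dec 1≤t c+t≤j x+t≤j+1 = cong (1 +_) (trans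
  (cong (λ n → sumBelow n (λ a → countSub a (tildeFrom j (suc t) l))) same-min)
  (sumBelow-cong (c ⊓ x) (λ a a<c⊓x → countSub-tildeFrom l j (suc t) a (Linked.tail dec) (s≤s z≤n)
    (subst (_≤ j) (sym (+-suc a t)) (≤-trans (+-monoˡ-≤ t (≤-trans a<c⊓x (m⊓n≤m c x))) c+t≤j))
    (next-head l dec))))
  where
  t≤j : t ≤ j
  t≤j = ≤-trans (m≤n+m t c) c+t≤j
  next-head : ∀ l → StrictDecreasing (x ∷ l) → head0 l + suc t ≤ suc j
  next-head []      _         = s≤s t≤j
  next-head (y ∷ l) (y<x ∷ _) = subst (_≤ suc j) (sym (+-suc y t)) (≤-trans (+-monoˡ-≤ t y<x) x+t≤j+1)
  same-min : c ⊓ tilde j t x ≡ c ⊓ x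
  same-min with x + t ∸ 1 ≟ j
  ... | no  _ = refl
  ... | yes x+t∸1≡j = trans (m≤n⇒m⊓n≡m c≤x∸1) (sym (m≤n⇒m⊓n≡m (≤-trans c≤x∸1 (m∸n≤m x 1))))
    where
    c≤x∸1 : c ≤ x ∸ 1
    c≤x∸1 = cancel x (subst (c + t ≤_) (sym x+t∸1≡j) c+t≤j)
      where
      cancel : ∀ x → c + t ≤ x + t ∸ 1 → c ≤ x ∸ 1
      cancel zero    c+t≤t∸1 = ⊥-elim (<-irrefl refl (≤∸1⇒< 1≤t (≤-trans (m≤n+m t c) c+t≤t∸1)))
      cancel (suc x) c+t≤x+t = +-cancelʳ-≤ t c x c+t≤x+t

if-then-0 : ∀ (p : Bool) {x : ℕ} → x ≡ 0 → (if p then x else 0) ≡ 0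
if-then-0 p x≡0 = trans (if-cong-then p x≡0) (if-eta p)

cornersOn-small : ∀ d b l → StrictDecreasing l → head0 l ≤ d → cornersOn d b l ≡ 0
cornersOn-small d b []      _   _   = refl
cornersOn-small d b (c ∷ l) dec c≤d = cong₂ _+_ (if-<ᵇ-no _ _ (≤-trans (m⊓n≤n b c) c≤d))
  (sumBelow-zeros (b ⊓ c) (λ a _ → if-then-0 (d <ᵇ a)
    (cornersOn-small d a l (Linked.tail dec) (≤-trans (head-tail≤ dec) c≤d))))

cornersOn-bound : ∀ d b b′ c l → b ⊓ c ≡ b′ ⊓ c → cornersOn d b (c ∷ l) ≡ cornersOn d b′ (c ∷ l)
cornersOn-bound d b b′ c l b⊓c≡b′⊓c = cong
  (λ m → (if d <ᵇ m then countSub (d ∸ 1) l else 0) + sumBelow m (λ a → if d <ᵇ a then cornersOn d a l else 0))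
  b⊓c≡b′⊓c

part-positive : ∀ l k → All (0 <_) l → 1 ≤ k → k ≤ length l → 0 < part l k
part-positive (c ∷ l) (suc zero)    (0<c ∷ _)     _ _       = 0<c
part-positive (c ∷ l) (suc (suc k)) (_ ∷ positive) _ (s≤s k≤n) = part-positive l (suc k) positive (s≤s z≤n) k≤n

lamLast : List ℕ → List ℕ
lamLast l = dropZeros (map (_∸ 1) (take (length l ∸ 1) l))

lamOther : List ℕ → ℕ → ℕ → List ℕ
lamOther l i j = dropZeros (map (_∸ 2) (take (i ∸ 1) l) ++ tildeFrom j (suc i) (drop i l))

lamAt-last : ∀ l → lamAt l (length l , length l) ≡ lamLast l
lamAt-last l with ≡-dec _≟_ _≟_ (length l , length l) (length l , length l)
... | yes _  = refl
... | no ≢nn = ⊥-elim (≢nn refl)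

lamAt-other : ∀ l i j → (i , j) ≢ (length l , length l) → lamAt l (i , j) ≡ lamOther l i j
lamAt-other l i j ≢nn with ≡-dec _≟_ _≟_ (i , j) (length l , length l)
... | yes ≡nn = ⊥-elim (≢nn ≡nn)
... | no  _   = refl

lamLast-∷ : ∀ a x l → 2 ≤ a → lamLast (a ∷ x ∷ l) ≡ (a ∸ 1) ∷ lamLast (x ∷ l)
lamLast-∷ (suc zero)    x l (s≤s ())
lamLast-∷ (suc (suc a)) x l _ = refl

lamOther-∷ : ∀ a l i d → 3 ≤ a →
  lamOther (a ∷ l) (suc (suc i)) (suc (suc i) + d) ≡ (a ∸ 2) ∷ lamOther l (suc i) (suc i + d)
lamOther-∷ (suc zero)             l i d (s≤s ())
lamOther-∷ (suc (suc zero))       l i d (s≤s (s≤s ()))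
lamOther-∷ (suc (suc (suc a))) l i d _ =
  cong (λ rest → suc a ∷ dropZeros (map (_∸ 2) (take i l) ++ rest)) (tildeFrom-suc (suc i + d) (suc i) (drop (suc i) l))

cornersOn-0 : ∀ l → StrictPartition l → 1 ≤ length l → ∀ b → cornersOn 0 (suc b) l ≡ countSub b (lamLast l)
cornersOn-0 (zero ∷ l)      (_ , () ∷ _) _ b
cornersOn-0 (suc a ∷ [])    _ _ b = cong (1 +_) (sumBelow-zeros (suc (b ⊓ a)) (λ k _ → if-eta (0 <ᵇ k)))
cornersOn-0 (suc a ∷ x ∷ l) (x<a ∷ dec , _ ∷ positive@(0<x ∷ _)) _ b = begin
  1 + sumBelow (b ⊓ a) (λ k → cornersOn 0 (suc k) (x ∷ l))
    ≡⟨ cong (1 +_) (sumBelow-cong (b ⊓ a) (λ k _ → cornersOn-0 (x ∷ l) (dec , positive) (s≤s z≤n) k)) ⟩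
  1 + sumBelow (b ⊓ a) (λ k → countSub k (lamLast (x ∷ l)))
    ≡⟨ cong (countSub b) (sym (lamLast-∷ (suc a) x l (≤-trans (s≤s 0<x) x<a))) ⟩
  countSub b (lamLast (suc a ∷ x ∷ l)) ∎

below-head : ∀ x l i d → StrictDecreasing (x ∷ l) → d < part (x ∷ l) (suc i) → d < x
below-head x l i d dec d<part = <-≤-trans d<part (part-≤-head (x ∷ l) (suc i) dec)

-- For bounds below d, λ(x) and λ without its first row have the same subdiagrams.
countSub-lamOther-below : ∀ a l i d c → StrictDecreasing (a ∷ l) → i ≤ length l →
  part (a ∷ l) (suc (suc i)) ≤ d → d < part (a ∷ l) (suc i) → c < d →
  countSub c (lamOther (a ∷ l) (suc i) (suc i + d)) ≡ countSub c l
countSub-lamOther-below a l zero d c dec _ next≤d _ c<d = begin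
  countSub c (dropZeros (tildeFrom (suc d) 2 l))
    ≡⟨ countSub-dropZeros c (tildeFrom (suc d) 2 l) (tildeFrom-weaklyDecreasing (suc d) 2 l (Linked.tail dec)) ⟩
  countSub c (tildeFrom (suc d) 2 l)
    ≡⟨ countSub-tildeFrom l (suc d) 2 c (Linked.tail dec) (s≤s z≤n) (subst (_≤ suc d) (+-comm 2 c) (s≤s c<d))
         (subst (_≤ suc (suc d)) (+-comm 2 _) (s≤s (s≤s (subst (_≤ d) (part-1 l) next≤d)))) ⟩
  countSub c l ∎
countSub-lamOther-below a (x ∷ l) (suc i) d c dec (s≤s i≤n) next≤d d<this c<d = begin
  countSub c (lamOther (a ∷ x ∷ l) (suc (suc i)) (suc (suc i) + d))
    ≡⟨ cong (countSub c) (lamOther-∷ a (x ∷ l) i d 3≤a) ⟩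
  countSub c ((a ∸ 2) ∷ lamOther (x ∷ l) (suc i) (suc i + d))
    ≡⟨ countSub-∷ c (a ∸ 2) (lamOther (x ∷ l) (suc i) (suc i + d)) c≤a∸2 ⟩
  1 + sumBelow c (λ k → countSub k (lamOther (x ∷ l) (suc i) (suc i + d)))
    ≡⟨ cong (1 +_) (sumBelow-cong c (λ k k<c →
         countSub-lamOther-below x l i d k (Linked.tail dec) i≤n next≤d d<this (<-trans k<c c<d))) ⟩
  1 + sumBelow c (λ k → countSub k l)
    ≡⟨ sym (countSub-∷ c x l (≤-trans (<⇒≤ c<d) (<⇒≤ d<x))) ⟩
  countSub c (x ∷ l) ∎
  where
  d<x : d < x
  d<x = below-head x l i d (Linked.tail dec) d<this
  d+2≤a : suc (suc d) ≤ a
  d+2≤a = ≤-trans (s≤s d<x) (Linked.head dec)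
  3≤a : 3 ≤ a
  3≤a = ≤-trans (s≤s (s≤s (≤-trans (s≤s z≤n) c<d))) d+2≤a
  c≤a∸2 : c ≤ a ∸ 2
  c≤a∸2 = ≤-trans (<⇒≤ c<d) (subst (_≤ a ∸ 2) (m+n∸m≡n 2 d) (∸-monoˡ-≤ 2 d+2≤a))

head-tildeFrom : ∀ d l → head0 l ≤ d → head0 (tildeFrom (suc d) 2 l) ≤ d ∸ 1
head-tildeFrom d []      _   = z≤n
head-tildeFrom d (y ∷ l) y≤d with y + 2 ∸ 1 ≟ suc d
... | yes _        = ∸-monoˡ-≤ 1 y≤d
... | no y+1≢d+1 = <⇒≤∸1 (≤∧≢⇒< y≤d (λ y≡d → y+1≢d+1 (trans (cong (λ z → z + 2 ∸ 1) y≡d) (cong (_∸ 1) (+-comm d 2)))))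

cornersOn-lamOther : ∀ a l i d b → StrictDecreasing (a ∷ l) → i ≤ length l →
  part (a ∷ l) (suc (suc i)) ≤ d → d < part (a ∷ l) (suc i) → 1 ≤ d → d < b →
  cornersOn d b (a ∷ l) ≡ countSub (b ∸ 2) (lamOther (a ∷ l) (suc i) (suc i + d))
cornersOn-lamOther a l zero (suc d′) b dec _ next≤d d<a _ d<b = begin
  cornersOn (suc d′) b (a ∷ l)
    ≡⟨ cong₂ _+_ (if-<ᵇ-yes (countSub d′ l) 0 (⊓-glb d<b d<a))
         (sumBelow-zeros (b ⊓ a) (λ k _ → if-then-0 (suc d′ <ᵇ k) (cornersOn-small (suc d′) k l (Linked.tail dec) head≤d))) ⟩
  countSub d′ l + 0
    ≡⟨ +-identityʳ _ ⟩
  countSub d′ l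
    ≡⟨ sym (countSub-tildeFrom l (suc (suc d′)) 2 d′ (Linked.tail dec) (s≤s z≤n) (≤-reflexive (+-comm d′ 2))
         (≤-trans (≤-reflexive (+-comm (head0 l) 2)) (s≤s (s≤s head≤d)))) ⟩
  countSub d′ (tildeFrom (suc (suc d′)) 2 l)
    ≡⟨ countSub-bound d′ (b ∸ 2) (tildeFrom (suc (suc d′)) 2 l) (head-tildeFrom (suc d′) l head≤d)
         (≤-trans (head-tildeFrom (suc d′) l head≤d) (∸-monoˡ-≤ 2 d<b)) ⟩
  countSub (b ∸ 2) (tildeFrom (suc (suc d′)) 2 l)
    ≡⟨ sym (countSub-dropZeros (b ∸ 2) (tildeFrom (suc (suc d′)) 2 l) (tildeFrom-weaklyDecreasing (suc (suc d′)) 2 l (Linked.tail dec))) ⟩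
  countSub (b ∸ 2) (lamOther (a ∷ l) 1 (1 + suc d′)) ∎
  where
  head≤d : head0 l ≤ suc d′
  head≤d = subst (_≤ suc d′) (part-1 l) next≤d
cornersOn-lamOther a (x ∷ l) (suc i) (suc d′) b dec (s≤s i≤n) next≤d d<this _ d<b = begin
  cornersOn d b (a ∷ x ∷ l)
    ≡⟨ cong₂ _+_ (if-<ᵇ-yes (countSub d′ (x ∷ l)) 0 d<m)
         (sumBelow-window m (suc d) m d<m ≤-refl (λ k d<k _ → if-<ᵇ-yes _ 0 d<k)
           (λ k k≤d → if-<ᵇ-no _ 0 (≤-pred k≤d)) (λ k m≤k k<m → ⊥-elim (<⇒≱ k<m m≤k))) ⟩
  countSub d′ (x ∷ l) + sumBelow (m ∸ suc d) (λ e → cornersOn d (suc d + e) (x ∷ l))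
    ≡⟨ cong₂ _+_ first-row (sumBelow-cong (m ∸ suc d) (λ e _ →
         cornersOn-lamOther x l i d (suc d + e) (Linked.tail dec) i≤n next≤d d<this (s≤s z≤n) (s≤s (m≤m+n d e)))) ⟩
  1 + (sumBelow d′ (λ k → countSub k L′) + sumBelow (m ∸ suc d) (λ e → countSub (d′ + e) L′))
    ≡⟨ cong (1 +_) (sym (sumBelow-split d′ (m ∸ suc d) (λ k → countSub k L′))) ⟩
  1 + sumBelow (d′ + (m ∸ suc d)) (λ k → countSub k L′)
    ≡⟨ cong (λ n → 1 + sumBelow n (λ k → countSub k L′)) (trans (cong (_∸ 2) (m+[n∸m]≡n d<m)) (∸-distribʳ-⊓ 2 b a)) ⟩
  countSub (b ∸ 2) ((a ∸ 2) ∷ L′)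
    ≡⟨ cong (countSub (b ∸ 2)) (sym (lamOther-∷ a (x ∷ l) i d 3≤a)) ⟩
  countSub (b ∸ 2) (lamOther (a ∷ x ∷ l) (suc (suc i)) (suc (suc i) + d)) ∎
  where
  d m : ℕ
  d = suc d′
  m = b ⊓ a
  L′ : List ℕ
  L′ = lamOther (x ∷ l) (suc i) (suc i + d)
  d<x : d < x
  d<x = below-head x l i d (Linked.tail dec) d<this
  d+2≤a : suc (suc d) ≤ a
  d+2≤a = ≤-trans (s≤s d<x) (Linked.head dec)
  3≤a : 3 ≤ a
  3≤a = ≤-trans (s≤s (s≤s (s≤s z≤n))) d+2≤a
  d<m : d < m
  d<m = ⊓-glb d<b (≤-trans (n≤1+n _) d+2≤a)
  first-row : countSub d′ (x ∷ l) ≡ 1 + sumBelow d′ (λ k → countSub k L′)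
  first-row = trans (countSub-∷ d′ x l (≤-trans (n≤1+n d′) (<⇒≤ d<x))) (cong (1 +_) (sumBelow-cong d′ (λ k k<d′ →
    sym (countSub-lamOther-below x l i d k (Linked.tail dec) i≤n next≤d d<this (m<n⇒m<1+n k<d′)))))

countSub≡R : ∀ c L → head0 L ≤ c → countSub c L ≡ R L
countSub≡R c L head≤c = trans (countSub-bound c (head0 L) L head≤c ≤-refl) (sym (R≡countSub L))

cornersOn-raise : ∀ d a l B → a ≤ B → cornersOn d a (a ∷ l) ≡ cornersOn d B (a ∷ l)
cornersOn-raise d a l B a≤B = cornersOn-bound d a B a l (trans (⊓-idem a) (sym (m≥n⇒m⊓n≡n a≤B)))

cornersOn≡R-lamAt : ∀ l → StrictPartition l → ∀ i d → i < length l →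
  part l (suc (suc i)) ≤ d → d < part l (suc i) → cornersOn d (head0 l) l ≡ R (lamAt l (suc i , suc i + d))
cornersOn≡R-lamAt (a ∷ l) sp@(_ , positive) i zero i<n next≤0 _ = begin
  cornersOn 0 a (a ∷ l)
    ≡⟨ cornersOn-raise 0 a l (suc (a + h)) (≤-trans (m≤m+n a h) (n≤1+n _)) ⟩
  cornersOn 0 (suc (a + h)) (a ∷ l)
    ≡⟨ cornersOn-0 (a ∷ l) sp (s≤s z≤n) (a + h) ⟩
  countSub (a + h) (lamLast (a ∷ l))
    ≡⟨ countSub≡R (a + h) (lamLast (a ∷ l)) (m≤n+m h a) ⟩
  R (lamLast (a ∷ l))
    ≡⟨ cong R (sym (lamAt-last (a ∷ l))) ⟩
  R (lamAt (a ∷ l) (length (a ∷ l) , length (a ∷ l)))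
    ≡⟨ cong (λ k → R (lamAt (a ∷ l) (k , k))) (sym last-row) ⟩
  R (lamAt (a ∷ l) (suc i , suc i))
    ≡⟨ cong (λ k → R (lamAt (a ∷ l) (suc i , k))) (sym (+-identityʳ (suc i))) ⟩
  R (lamAt (a ∷ l) (suc i , suc i + 0)) ∎
  where
  h : ℕ
  h = head0 (lamLast (a ∷ l))
  last-row : suc i ≡ length (a ∷ l)
  last-row with suc (suc i) ≤? length (a ∷ l)
  ... | yes i+2≤n = ⊥-elim (<⇒≱ (part-positive (a ∷ l) (suc (suc i)) positive (s≤s z≤n) i+2≤n) next≤0)
  ... | no  i+2≰n = ≤-antisym i<n (≤-pred (≰⇒> i+2≰n))
cornersOn≡R-lamAt (a ∷ l) (dec , _) i (suc d′) i<n next≤d d<this = begin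
  cornersOn d a (a ∷ l)
    ≡⟨ cornersOn-raise d a l (a + h + 2) (≤-trans (m≤m+n a h) (m≤m+n (a + h) 2)) ⟩
  cornersOn d (a + h + 2) (a ∷ l)
    ≡⟨ cornersOn-lamOther a l i d (a + h + 2) dec (≤-pred i<n) next≤d d<this (s≤s z≤n)
         (<-≤-trans d<this (≤-trans (part-≤-head (a ∷ l) (suc i) dec) (≤-trans (m≤m+n a h) (m≤m+n (a + h) 2)))) ⟩
  countSub (a + h + 2 ∸ 2) L
    ≡⟨ countSub≡R (a + h + 2 ∸ 2) L (subst (h ≤_) (sym (m+n∸n≡m (a + h) 2)) (m≤n+m h a)) ⟩
  R L
    ≡⟨ cong R (sym (lamAt-other (a ∷ l) (suc i) (suc i + d) off-diagonal)) ⟩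
  R (lamAt (a ∷ l) (suc i , suc i + d)) ∎
  where
  d h : ℕ
  d = suc d′
  L : List ℕ
  L = lamOther (a ∷ l) (suc i) (suc i + d)
  h = head0 L
  off-diagonal : (suc i , suc i + d) ≢ (length (a ∷ l) , length (a ∷ l))
  off-diagonal eq = m+1+n≢m (suc i) (trans (cong proj₂ eq) (sym (cong proj₁ eq)))

proposition5p1 : (λ′ : List ℕ) → StrictPartition λ′ →
    Rplus1 λ′ ≡ sum (map (λ x → R (lamAt λ′ x)) (border λ′))
proposition5p1 l sp@(dec , _) = begin
  Rplus1 l
    ≡⟨ Rplus1≡sumSub-corners l ⟩
  sumSub corners (head0 l) l
    ≡⟨ sumSub-corners≡sum-cornersOn (head0 l) l (head0 l) (m⊓n≤m (head0 l) (head0 l)) ⟩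
  sumBelow (head0 l) (λ d → cornersOn d (head0 l) l)
    ≡⟨ sumBelow-rows (λ d → cornersOn d (head0 l) l) l dec ⟩
  sumBelow (length l) (λ i → sumBelow (width i) (λ e → cornersOn (next i + e) (head0 l) l))
    ≡⟨ sumBelow-cong (length l) (λ i i<n → sumBelow-cong (width i) (λ e e<width → trans
         (cornersOn≡R-lamAt l sp i (next i + e) i<n (m≤m+n (next i) e) (on-row i e e<width))
         (cong (λ j → R (lamAt l (suc i , j))) (sym (+-assoc (suc i) (next i) e))))) ⟩
  sumBelow (length l) (λ i → sumBelow (width i) (λ e → R (lamAt l (suc i , suc i + next i + e))))
    ≡⟨ sym (sum-border l (λ x → R (lamAt l x)) dec) ⟩
  sum (map (λ x → R (lamAt l x)) (border l)) ∎
  where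
  next width : ℕ → ℕ
  next i = part l (suc (suc i))
  width i = part l (suc i) ∸ next i
  on-row : ∀ i e → e < width i → next i + e < part l (suc i)
  on-row i e e<width = subst (next i + e <_) (m+[n∸m]≡n (part-suc-≤ l i dec)) (+-monoʳ-< (next i) e<width)
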